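{- If $G$ is a finite connected graph with $|V(G)|=n$, then for every integer $k\ge 1$, $F_{cd}(G\odot^k K_1) = 2^{k-1} n$.
   Context: The corona $G\odot H$ is obtained from one copy of $G$ and $|V(G)|$ disjoint copies of $H$ by joining every vertex of the $i$-th copy of $H$ to the $i$-th vertex of $G$; in particular $G\odot K_1$ attaches one pendant vertex to each vertex of $G$. Define $G\odot^1 K_1 = G\odot K_1$ and $G\odot^k K_1 = (G\odot^{k-1} K_1)\odot K_1$ for $k\ge2$. Color-change rule: if each vertex is colored black or white, and a black vertex $u$ has exactly one white neighbor $v$, then $v$ is recolored black. A zero forcing set is a vertex set $Z$ such that, starting with exactly the vertices of $Z$ black, repeated application of the color-change rule colors every vertex black. A connected dom-forcing set is a vertex set $S$ that is dominating, induces a connected subgraph, and is a zero forcing set; $F_{cd}(\cdot)$ is the minimum size of such a set. -}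

module Defs where

open import Data.Nat using (ℕ; zero; suc; _+_; _*_; _∸_; _^_; _≤_)
open import Data.Fin using (Fin; splitAt)
open import Data.Fin.Subset using (Subset; _∈_; _∉_; ∣_∣)
open import Data.Sum using (_⊎_; inj₁; inj₂)
open import Data.Product using (Σ; ∃; _×_; _,_)
open import Data.Unit using (⊤)
open import Data.Bool using (Bool; true; false)
open import Relation.Binary.PropositionalEquality using (_≡_; _≢_)
open import Relation.Nullary using (¬_; does)
open import Data.Fin.Properties using (_≟_)

record Graph : Set where
  constructor graph
  field
    order : ℕ
    adj   : Fin order → Fin order → Bool
open Graph public

Adj : (G : Graph) → Fin (order G) → Fin (order G) → Set
Adj G u v = adj G u v ≡ true

IsSimple : Graph → Set
IsSimple G = (∀ u v → adj G u v ≡ adj G v u) × (∀ v → adj G v v ≡ false)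

data WalkIn (G : Graph) (P : Fin (order G) → Set) : Fin (order G) → Fin (order G) → Set where
  here : ∀ {u} → P u → WalkIn G P u u
  step : ∀ {u w v} → P u → Adj G u w → WalkIn G P w v → WalkIn G P u v

Connected : Graph → Set
Connected G = ∀ u v → WalkIn G (λ _ → ⊤) u v

-- corona G ⊙ K₁ : vertices inj₁ i (copy of G) and inj₂ i (pendant attached to i),
-- encoded in Fin (n + n) via splitAt.
coronaAdj : (n : ℕ) → (Fin n → Fin n → Bool) → Fin (n + n) → Fin (n + n) → Bool
coronaAdj n a x y with splitAt n x | splitAt n y
... | inj₁ i | inj₁ j = a i j
... | inj₁ i | inj₂ j = does (i ≟ j)
... | inj₂ i | inj₁ j = does (i ≟ j)
... | inj₂ i | inj₂ j = false

corona : Graph → Graph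
corona G = graph (order G + order G) (coronaAdj (order G) (adj G))

coronaIter : ℕ → Graph → Graph
coronaIter zero    G = G
coronaIter (suc k) G = corona (coronaIter k G)

-- Forced G Z v : v becomes black starting from black set Z under repeated color changes
-- (least set containing Z closed under the color-change rule).
data Forced (G : Graph) (Z : Subset (order G)) : Fin (order G) → Set where
  init  : ∀ {v} → v ∈ Z → Forced G Z v
  force : ∀ {u v} → Forced G Z u → Adj G u v →
          (∀ w → Adj G u w → w ≢ v → Forced G Z w) → Forced G Z v

IsZeroForcing : (G : Graph) → Subset (order G) → Set
IsZeroForcing G Z = ∀ v → Forced G Z v

IsDominating : (G : Graph) → Subset (order G) → Set
IsDominating G S = ∀ v → v ∈ S ⊎ ∃ λ u → u ∈ S × Adj G u v

InducesConnected : (G : Graph) → Subset (order G) → Set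
InducesConnected G S = ∀ u v → u ∈ S → v ∈ S → WalkIn G (λ w → w ∈ S) u v

IsConnectedDomForcing : (G : Graph) → Subset (order G) → Set
IsConnectedDomForcing G S = IsDominating G S × InducesConnected G S × IsZeroForcing G S

FcdIs : Graph → ℕ → Set
FcdIs G m = (Σ (Subset (order G)) λ S → IsConnectedDomForcing G S × ∣ S ∣ ≡ m)
          × (∀ S → IsConnectedDomForcing G S → m ≤ ∣ S ∣)

-- In H ⊙ K₁ the pendant vertex attached to i is adjacent only to i, so every
-- dominating set contains i or its pendant, for each of the n vertices i of H:
-- hence F_cd(H ⊙ K₁) ≥ n. Conversely the copy of H is a connected dominating set
-- of size n, and it is zero forcing because each vertex of H has its pendant as
-- its only white neighbour. So F_cd(H ⊙ K₁) = |V(H)| for every connected H, and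
-- the theorem follows with H = G ⊙^(k-1) K₁, which is connected and has 2^(k-1) n
-- vertices.
module Submission where

open import Defs
open import Data.Nat using (ℕ; zero; suc; _+_; _*_; _∸_; _^_; _≤_; z≤n; s≤s)
open import Data.Nat.Properties
  using (≤-trans; +-monoʳ-≤; +-suc; +-identityʳ; *-identityˡ; *-assoc; module ≤-Reasoning)
open import Data.Fin using (Fin; zero; suc; splitAt; _↑ˡ_; _↑ʳ_)
open import Data.Fin.Properties using (_≟_; splitAt-↑ˡ; splitAt-↑ʳ; splitAt⁻¹-↑ˡ; splitAt⁻¹-↑ʳ)
open import Data.Fin.Subset using (Subset; inside; outside; _∈_; _∉_; _⊆_; _∪_; ∣_∣; ⊤; ⊥)
open import Data.Fin.Subset.Properties using (∈⊤; ∉⊥; ∣⊤∣≡n; ∣⊥∣≡0; ∣p∣≤∣x∷p∣; p⊆q⇒∣p∣≤∣q∣; x∈p∪q⁺)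
open import Data.Vec using ([]; _∷_; _++_; here; there)
import Data.Vec as Vec
open import Data.Sum using (_⊎_; inj₁; inj₂)
open import Data.Product using (∃; _×_; _,_; proj₁)
open import Data.Unit using (tt) renaming (⊤ to Unit)
open import Data.Bool using (false)
open import Data.Empty using (⊥-elim)
open import Relation.Nullary using (does; yes; no)
open import Relation.Nullary.Decidable using (dec-true)
open import Relation.Binary.PropositionalEquality
  using (_≡_; _≢_; refl; sym; trans; cong; cong₂; subst; module ≡-Reasoning)

∣p++q∣≡∣p∣+∣q∣ : ∀ {m n} (p : Subset m) (q : Subset n) → ∣ p ++ q ∣ ≡ ∣ p ∣ + ∣ q ∣
∣p++q∣≡∣p∣+∣q∣ []            q = refl
∣p++q∣≡∣p∣+∣q∣ (inside  ∷ p) q = cong suc (∣p++q∣≡∣p∣+∣q∣ p q)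
∣p++q∣≡∣p∣+∣q∣ (outside ∷ p) q = ∣p++q∣≡∣p∣+∣q∣ p q

∣p∪q∣≤∣p∣+∣q∣ : ∀ {n} (p q : Subset n) → ∣ p ∪ q ∣ ≤ ∣ p ∣ + ∣ q ∣
∣p∪q∣≤∣p∣+∣q∣ []            []            = z≤n
∣p∪q∣≤∣p∣+∣q∣ (inside  ∷ p) (y       ∷ q) =
  s≤s (≤-trans (∣p∪q∣≤∣p∣+∣q∣ p q) (+-monoʳ-≤ ∣ p ∣ (∣p∣≤∣x∷p∣ y q)))
∣p∪q∣≤∣p∣+∣q∣ (outside ∷ p) (outside ∷ q) = ∣p∪q∣≤∣p∣+∣q∣ p q
∣p∪q∣≤∣p∣+∣q∣ (outside ∷ p) (inside  ∷ q) =
  subst (suc ∣ p ∪ q ∣ ≤_) (sym (+-suc ∣ p ∣ ∣ q ∣)) (s≤s (∣p∪q∣≤∣p∣+∣q∣ p q))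

n≤∣p++q∣ : ∀ {n} (p q : Subset n) → (∀ i → i ∈ p ⊎ i ∈ q) → n ≤ ∣ p ++ q ∣
n≤∣p++q∣ {n} p q cover = begin
  n               ≡⟨ sym (∣⊤∣≡n n) ⟩
  ∣ ⊤ {n} ∣       ≤⟨ p⊆q⇒∣p∣≤∣q∣ ⊤⊆p∪q ⟩
  ∣ p ∪ q ∣       ≤⟨ ∣p∪q∣≤∣p∣+∣q∣ p q ⟩
  ∣ p ∣ + ∣ q ∣   ≡⟨ sym (∣p++q∣≡∣p∣+∣q∣ p q) ⟩
  ∣ p ++ q ∣      ∎
  where
  open ≤-Reasoning
  ⊤⊆p∪q : ⊤ {n} ⊆ p ∪ q
  ⊤⊆p∪q {i} _ = x∈p∪q⁺ (cover i)

∈-++⁺ˡ : ∀ {m n} {p : Subset m} {i} (q : Subset n) → i ∈ p → i ↑ˡ n ∈ p ++ q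
∈-++⁺ˡ q here        = here
∈-++⁺ˡ q (there i∈p) = there (∈-++⁺ˡ q i∈p)

∈-++⁻ˡ : ∀ {m n} (p : Subset m) {q : Subset n} i → i ↑ˡ n ∈ p ++ q → i ∈ p
∈-++⁻ˡ (_ ∷ p) zero    here      = here
∈-++⁻ˡ (_ ∷ p) (suc i) (there h) = there (∈-++⁻ˡ p i h)

∈-++⁻ʳ : ∀ {m n} (p : Subset m) {q : Subset n} i → m ↑ʳ i ∈ p ++ q → i ∈ q
∈-++⁻ʳ []      i h         = h
∈-++⁻ʳ (_ ∷ p) i (there h) = ∈-++⁻ʳ p i h

_++ʷ_ : ∀ {G P u v w} → WalkIn G P u v → WalkIn G P v w → WalkIn G P u w
here _     ++ʷ q = q
step p a w ++ʷ q = step p a (w ++ʷ q)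

module CoronaK₁ (H : Graph) where

  private
    n : ℕ
    n = order H

    C : Graph
    C = corona H

  base : Fin n → Fin (n + n)
  base i = i ↑ˡ n

  pendant : Fin n → Fin (n + n)
  pendant i = n ↑ʳ i

  data VertexView : Fin (n + n) → Set where
    isBase    : ∀ i → VertexView (base i)
    isPendant : ∀ i → VertexView (pendant i)

  vertexView : ∀ x → VertexView x
  vertexView x with splitAt n x in eq
  ... | inj₁ i = subst VertexView (splitAt⁻¹-↑ˡ eq) (isBase i)
  ... | inj₂ i = subst VertexView (splitAt⁻¹-↑ʳ eq) (isPendant i)

  adj-base-base : ∀ i j → adj C (base i) (base j) ≡ adj H i j
  adj-base-base i j rewrite splitAt-↑ˡ n i n | splitAt-↑ˡ n j n = refl

  adj-base-pendant : ∀ i j → adj C (base i) (pendant j) ≡ does (i ≟ j)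
  adj-base-pendant i j rewrite splitAt-↑ˡ n i n | splitAt-↑ʳ n n j = refl

  adj-pendant-base : ∀ i j → adj C (pendant i) (base j) ≡ does (i ≟ j)
  adj-pendant-base i j rewrite splitAt-↑ʳ n n i | splitAt-↑ˡ n j n = refl

  adj-pendant-pendant : ∀ i j → adj C (pendant i) (pendant j) ≡ false
  adj-pendant-pendant i j rewrite splitAt-↑ʳ n n i | splitAt-↑ʳ n n j = refl

  base-adj-pendant : ∀ i → Adj C (base i) (pendant i)
  base-adj-pendant i = trans (adj-base-pendant i i) (dec-true (i ≟ i) refl)

  pendant-adj-base : ∀ i → Adj C (pendant i) (base i)
  pendant-adj-base i = trans (adj-pendant-base i i) (dec-true (i ≟ i) refl)

  base-adj-pendant⇒≡ : ∀ {i j} → Adj C (base i) (pendant j) → i ≡ j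
  base-adj-pendant⇒≡ {i} {j} a with i ≟ j | trans (sym (adj-base-pendant i j)) a
  ... | yes i≡j | _ = i≡j
  ... | no  _   | ()

  neighbour-of-pendant : ∀ {u i} → Adj C u (pendant i) → u ≡ base i
  neighbour-of-pendant {u} {i} a with vertexView u
  ... | isBase j    = cong base (base-adj-pendant⇒≡ a)
  ... | isPendant j with trans (sym (adj-pendant-pendant j i)) a
  ...   | ()

  lift-walk : ∀ {P Q u v} → (∀ i → P (base i)) → WalkIn H Q u v → WalkIn C P (base u) (base v)
  lift-walk P-base (here _)             = here (P-base _)
  lift-walk P-base (step {u} {w} _ a p) = step (P-base u) (trans (adj-base-base u w) a) (lift-walk P-base p)

  reach-base : ∀ x → ∃ λ i → WalkIn C (λ _ → Unit) x (base i) × WalkIn C (λ _ → Unit) (base i) x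
  reach-base x with vertexView x
  ... | isBase i    = i , here tt , here tt
  ... | isPendant i = i , step tt (pendant-adj-base i) (here tt) , step tt (base-adj-pendant i) (here tt)

  corona-connected : Connected H → Connected C
  corona-connected connected u v with reach-base u | reach-base v
  ... | i , u⇝i , _ | j , _ , j⇝v = u⇝i ++ʷ (lift-walk (λ _ → tt) (connected i j) ++ʷ j⇝v)

  baseSet : Subset (n + n)
  baseSet = ⊤ ++ ⊥ {n}

  base∈baseSet : ∀ i → base i ∈ baseSet
  base∈baseSet i = ∈-++⁺ˡ (⊥ {n}) ∈⊤

  pendant∉baseSet : ∀ i → pendant i ∉ baseSet
  pendant∉baseSet i p = ∉⊥ (∈-++⁻ʳ (⊤ {n}) i p)

  ∣baseSet∣ : ∣ baseSet ∣ ≡ n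
  ∣baseSet∣ = begin
    ∣ ⊤ {n} ++ ⊥ {n} ∣      ≡⟨ ∣p++q∣≡∣p∣+∣q∣ (⊤ {n}) ⊥ ⟩
    ∣ ⊤ {n} ∣ + ∣ ⊥ {n} ∣   ≡⟨ cong₂ _+_ (∣⊤∣≡n n) (∣⊥∣≡0 n) ⟩
    n + 0                   ≡⟨ +-identityʳ n ⟩
    n                       ∎
    where open ≡-Reasoning

  baseSet-dominating : IsDominating C baseSet
  baseSet-dominating x with vertexView x
  ... | isBase i    = inj₁ (base∈baseSet i)
  ... | isPendant i = inj₂ (base i , base∈baseSet i , base-adj-pendant i)

  baseSet-connected : Connected H → InducesConnected C baseSet
  baseSet-connected connected u v u∈S v∈S with vertexView u | vertexView v
  ... | isBase i    | isBase j    = lift-walk base∈baseSet (connected i j)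
  ... | isPendant i | _           = ⊥-elim (pendant∉baseSet i u∈S)
  ... | isBase _    | isPendant j = ⊥-elim (pendant∉baseSet j v∈S)

  baseSet-zeroForcing : IsZeroForcing C baseSet
  baseSet-zeroForcing x with vertexView x
  ... | isBase i    = init (base∈baseSet i)
  ... | isPendant i = force (init (base∈baseSet i)) (base-adj-pendant i) others-black
    where
    others-black : ∀ w → Adj C (base i) w → w ≢ pendant i → Forced C baseSet w
    others-black w a w≢ with vertexView w
    ... | isBase j    = init (base∈baseSet j)
    ... | isPendant j = ⊥-elim (w≢ (cong pendant (sym (base-adj-pendant⇒≡ a))))

  dominating⇒n≤∣S∣ : ∀ S → IsDominating C S → n ≤ ∣ S ∣
  dominating⇒n≤∣S∣ S dominating with Vec.splitAt n S
  ... | l , r , refl = n≤∣p++q∣ l r cover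
    where
    cover : ∀ i → i ∈ l ⊎ i ∈ r
    cover i with dominating (pendant i)
    ... | inj₁ pendant∈S             = inj₂ (∈-++⁻ʳ l i pendant∈S)
    ... | inj₂ (u , u∈S , u~pendant) =
      inj₁ (∈-++⁻ˡ l i (subst (_∈ l ++ r) (neighbour-of-pendant u~pendant) u∈S))

  corona-Fcd : Connected H → FcdIs C n
  corona-Fcd connected =
    (baseSet , (baseSet-dominating , baseSet-connected connected , baseSet-zeroForcing) , ∣baseSet∣) ,
    λ S cdf → dominating⇒n≤∣S∣ S (proj₁ cdf)

open CoronaK₁ using (corona-connected; corona-Fcd)

coronaIter-connected : ∀ G → Connected G → ∀ k → Connected (coronaIter k G)
coronaIter-connected G connected zero    = connected
coronaIter-connected G connected (suc k) =
  corona-connected (coronaIter k G) (coronaIter-connected G connected k)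

order-coronaIter : ∀ G k → order (coronaIter k G) ≡ 2 ^ k * order G
order-coronaIter G zero    = sym (*-identityˡ (order G))
order-coronaIter G (suc k) = begin
  m + m                 ≡⟨ cong (m +_) (sym (+-identityʳ m)) ⟩
  2 * m                 ≡⟨ cong (2 *_) (order-coronaIter G k) ⟩
  2 * (2 ^ k * order G) ≡⟨ sym (*-assoc 2 (2 ^ k) (order G)) ⟩
  2 ^ suc k * order G   ∎
  where
  open ≡-Reasoning
  m : ℕ
  m = order (coronaIter k G)

mainTheorem13 : (G : Graph) → IsSimple G → Connected G →
    (k : ℕ) → 1 ≤ k → FcdIs (coronaIter k G) (2 ^ (k ∸ 1) * order G)
mainTheorem13 G _ connected (suc k) _ =
  subst (FcdIs (coronaIter (suc k) G)) (order-coronaIter G k)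
    (corona-Fcd (coronaIter k G) (coronaIter-connected G connected k))
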